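{- Let $p$ be a prime. For any set $D\subset\mathbb{F}_p$ with $|D|$ odd and $|D|\le(2p+1)/3$, we have $$\sum_{x,y\in D} D(x-y)\le \frac34|D|^2+\frac14,$$ where $D(\cdot)$ denotes the indicator function of $D$.
   Context: $\mathbb{F}_p$ is the additive group of prime order $p$. Equivalently, the left-hand side counts triples $(x,y,z)\in D^3$ with $x-y=z$. -}

module Defs where

open import Data.Nat using (ℕ; _+_; _∸_; NonZero)
open import Data.Nat.DivMod using (_mod_)
open import Data.Fin using (Fin; toℕ)
open import Data.Fin.Subset using (Subset; inside; outside)
open import Data.Vec using (lookup)
open import Data.List using (List; allFin; map)
open import Data.Nat.ListAction using (sum)
open import Data.Bool using (true; false)

_⊖_ : ∀ {p} .{{_ : NonZero p}} → Fin p → Fin p → Fin p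
_⊖_ {p} x y = (toℕ x + (p ∸ toℕ y)) mod p

ind : ∀ {p} → Subset p → Fin p → ℕ
ind D x with lookup D x
... | inside  = 1
... | outside = 0

Σ[_] : ∀ {p} → (Fin p → ℕ) → ℕ
Σ[ f ] = sum (map f (allFin _))

triples : ∀ {p} .{{_ : NonZero p}} → Subset p → ℕ
triples D = Σ[ (λ x → Σ[ (λ y → ind D x * ind D y * ind D (x ⊖ y)) ]) ]
  where open Data.Nat using (_*_)

-- With F the complement of D, the triples count is |D|² − r_F(D, D), where r_F(A, B) counts
-- the pairs (x, y) ∈ A × B with x − y ∈ F. A Pollard-type inequality bounds r_F from below:
-- if t ≤ |A|, t ≤ |B| and |A| + |B| ≤ p + t then t (|A| + |B| + |F| − p − t) ≤ r_F(A, B).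
-- When |B| = t this is inclusion–exclusion, |A ∩ (y + F)| ≥ |A| + |F| − p, summed over y ∈ B.
-- Otherwise B has two points b₁ ≠ b₂, and since p is prime and A ≠ Fin p some e has
-- e − b₁ ∈ A, e − b₂ ∉ A. Dyson's e-transform replaces (A, B) by (A ∪ (e − B), B ∩ (e − A)) and
-- (A ∖ (e − B), B ∖ (e − A)); both second components are smaller, r_F is additive over the split,
-- and induction on |B| closes the argument. For |D| = 2k + 1 and t = k + 1 the inequality gives
-- r_F(D, D) ≥ k (k + 1), that is 4 (|D|² − r_F(D, D)) ≤ 3 |D|² + 1.

module Submission where

open import Defs
open import Data.Bool using (Bool; true; false; not; _∧_; _∨_)
import Data.Bool as Bool
open import Data.Bool.Properties using (∧-comm)
open import Data.Fin using (Fin; toℕ; zero; suc; punchIn)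
open import Data.Fin.Permutation using (permutation)
open import Data.Fin.Properties using (toℕ-injective; toℕ<n; toℕ-fromℕ<; punchInᵢ≢i; any?)
open import Data.Fin.Subset using (Subset; ∣_∣)
open import Data.List using (tabulate)
import Data.List.Properties as List
open import Data.Nat using (ℕ; zero; suc; pred; _+_; _*_; _∸_; _≤_; _<_; z≤n; s≤s; s≤s⁻¹; _≤?_; NonZero; ≢-nonZero)
open import Data.Nat.Coprimality using (coprime-Bézout; prime⇒coprime)
open import Data.Nat.DivMod
open import Data.Nat.GCD using (module Bézout)
import Data.Nat.ListAction as ListSum
open import Data.Nat.Primality using (Prime)
open import Data.Nat.Properties
open import Data.Nat.Tactic.RingSolver using (solve-∀)
open import Algebra.Properties.Semiring.Sum +-*-semiring
  using (sum; sum-cong-≗; sum-remove; ∑-distrib-+; ∑-comm; ∑-permute; *-distribˡ-sum; *-distribʳ-sum)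
open import Data.Product using (∃-syntax; _×_; _,_; proj₁; proj₂)
open import Data.Vec using ([]; _∷_; lookup)
open import Data.Vec.Functional using (removeAt)
open import Function using (_on_; _∘_; id)
open import Relation.Binary using (Rel; Setoid)
import Relation.Binary.Construct.On as On
open import Relation.Binary.PropositionalEquality
import Relation.Binary.Reasoning.Setoid as SetoidReasoning
open import Relation.Nullary using (yes; no; contradiction)
open import Relation.Nullary.Decidable using (_×-dec_)
open import Relation.Unary using (Pred)

sum-mono-≤ : ∀ {n} {f g : Fin n → ℕ} → (∀ i → f i ≤ g i) → sum f ≤ sum g
sum-mono-≤ {zero}  f≤g = z≤n
sum-mono-≤ {suc n} f≤g = +-mono-≤ (f≤g zero) (sum-mono-≤ (f≤g ∘ suc))

sum-const-1 : ∀ n → sum {n} (λ _ → 1) ≡ n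
sum-const-1 zero    = refl
sum-const-1 (suc n) = cong suc (sum-const-1 n)

term≤sum : ∀ {n} (f : Fin n → ℕ) i → f i ≤ sum f
term≤sum {suc n} f i = subst (f i ≤_) (sym (sum-remove f)) (m≤m+n (f i) _)

∃-nonzero : ∀ {n} (f : Fin n → ℕ) → sum f ≢ 0 → ∃[ i ] f i ≢ 0
∃-nonzero {zero}  f sum≢0 = contradiction refl sum≢0
∃-nonzero {suc n} f sum≢0 with f zero ≟ 0
... | no  f₀≢0 = zero , f₀≢0
... | yes f₀≡0 with ∃-nonzero (f ∘ suc) (sum≢0 ∘ cong₂ _+_ f₀≡0)
...   | i , fᵢ≢0 = suc i , fᵢ≢0

∃-nonzero-≢ : ∀ {n} (f : Fin n → ℕ) i → f i < sum f → ∃[ j ] j ≢ i × f j ≢ 0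
∃-nonzero-≢ {suc n} f i fᵢ<sum with ∃-nonzero (removeAt f i) rest≢0
  where
  rest≢0 : sum (removeAt f i) ≢ 0
  rest≢0 rest≡0 = <-irrefl (sym (trans (sum-remove f) (trans (cong (f i +_) rest≡0) (+-identityʳ (f i))))) fᵢ<sum
... | j , fⱼ≢0 = punchIn i j , punchInᵢ≢i i j , fⱼ≢0

∑∑-distrib-+ : ∀ {m n} (f g : Fin m → Fin n → ℕ) →
               sum (λ i → sum (λ j → f i j + g i j)) ≡ sum (λ i → sum (f i)) + sum (λ i → sum (g i))
∑∑-distrib-+ f g =
  trans (sum-cong-≗ (λ i → ∑-distrib-+ (f i) (g i))) (∑-distrib-+ (λ i → sum (f i)) (λ i → sum (g i)))

sum-tabulate : ∀ {n} (f : Fin n → ℕ) → ListSum.sum (tabulate f) ≡ sum f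
sum-tabulate {zero}  f = refl
sum-tabulate {suc n} f = cong (f zero +_) (sum-tabulate (f ∘ suc))

Σ[]≡sum : ∀ {n} (f : Fin n → ℕ) → Σ[ f ] ≡ sum f
Σ[]≡sum {n} f = trans (cong ListSum.sum (List.map-tabulate id f)) (sum-tabulate f)

χ : Bool → ℕ
χ false = 0
χ true  = 1

χ≢0⇒true : ∀ {b} → χ b ≢ 0 → b ≡ true
χ≢0⇒true {false} χb≢0 = contradiction refl χb≢0
χ≢0⇒true {true}  _    = refl

χ-+-not : ∀ b → χ b + χ (not b) ≡ 1
χ-+-not false = refl
χ-+-not true  = refl

χ-+-≤ : ∀ a b → χ a + χ b ≤ χ a * χ b + 1
χ-+-≤ false false = z≤n
χ-+-≤ false true  = ≤-refl
χ-+-≤ true  false = ≤-refl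
χ-+-≤ true  true  = ≤-refl

χ-split-∧ : ∀ a b → χ a ≡ χ (a ∧ b) + χ (a ∧ not b)
χ-split-∧ false b     = refl
χ-split-∧ true  false = refl
χ-split-∧ true  true  = refl

χ-split-∨ : ∀ a b → χ (a ∨ b) ≡ χ a + χ (b ∧ not a)
χ-split-∨ false false = refl
χ-split-∨ false true  = refl
χ-split-∨ true  false = refl
χ-split-∨ true  true  = refl

card : ∀ {n} → (Fin n → Bool) → ℕ
card A = sum (χ ∘ A)

card-∃ : ∀ {n} (A : Fin n → Bool) → 1 ≤ card A → ∃[ x ] A x ≡ true
card-∃ A 1≤∣A∣ with ∃-nonzero (χ ∘ A) (λ ∣A∣≡0 → <⇒≢ 1≤∣A∣ (sym ∣A∣≡0))
... | x , χAx≢0 = x , χ≢0⇒true χAx≢0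

card-∃₂ : ∀ {n} (A : Fin n → Bool) → 2 ≤ card A →
          ∃[ x ] ∃[ y ] x ≢ y × A x ≡ true × A y ≡ true
card-∃₂ A 2≤∣A∣ with card-∃ A (≤-trans (s≤s z≤n) 2≤∣A∣)
... | x , Ax with ∃-nonzero-≢ (χ ∘ A) x (subst (λ b → χ b < card A) (sym Ax) 2≤∣A∣)
...   | y , y≢x , χAy≢0 = x , y , ≢-sym y≢x , Ax , χ≢0⇒true χAy≢0

card-universal : ∀ {n} (A : Fin n → Bool) → (∀ x → A x ≡ true) → card A ≡ n
card-universal {n} A all = trans (sum-cong-≗ (cong χ ∘ all)) (sum-const-1 n)

ind≡χ∘lookup : ∀ {n} (D : Subset n) x → ind D x ≡ χ (lookup D x)
ind≡χ∘lookup D x with lookup D x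
... | true  = refl
... | false = refl

∣∣≡card : ∀ {n} (D : Subset n) → ∣ D ∣ ≡ card (lookup D)
∣∣≡card []          = refl
∣∣≡card (true ∷ D)  = cong suc (∣∣≡card D)
∣∣≡card (false ∷ D) = ∣∣≡card D

card-+-complement : ∀ {n} (A : Fin n → Bool) → card A + card (not ∘ A) ≡ n
card-+-complement {n} A =
  trans (sym (∑-distrib-+ (χ ∘ A) (χ ∘ not ∘ A))) (trans (sum-cong-≗ (χ-+-not ∘ A)) (sum-const-1 n))

-- Arithmetic modulo p

module _ {p : ℕ} .{{_ : NonZero p}} where

  infix 4 _≈_
  _≈_ : Rel ℕ _
  _≈_ = _≡_ on (_% p)

  ≈-setoid : Setoid _ _
  ≈-setoid = On.setoid (setoid ℕ) (_% p)

  module ≈-Reasoning = SetoidReasoning ≈-setoid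

  +-cong-≈ : ∀ {a b c d} → a ≈ b → c ≈ d → a + c ≈ b + d
  +-cong-≈ {a} {b} {c} {d} a≈b c≈d = begin
    (a + c) % p              ≡⟨ %-distribˡ-+ a c p ⟩
    (a % p + c % p) % p      ≡⟨ cong₂ (λ u v → (u + v) % p) a≈b c≈d ⟩
    (b % p + d % p) % p      ≡⟨ %-distribˡ-+ b d p ⟨
    (b + d) % p              ∎
    where open ≡-Reasoning

  *-cong-≈ : ∀ {a b c d} → a ≈ b → c ≈ d → a * c ≈ b * d
  *-cong-≈ {a} {b} {c} {d} a≈b c≈d = begin
    (a * c) % p              ≡⟨ %-distribˡ-* a c p ⟩
    (a % p * (c % p)) % p    ≡⟨ cong₂ (λ u v → (u * v) % p) a≈b c≈d ⟩
    (b % p * (d % p)) % p    ≡⟨ %-distribˡ-* b d p ⟨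
    (b * d) % p              ∎
    where open ≡-Reasoning

  +-*-multiple-≈ : ∀ m k → m + k * p ≈ m
  +-*-multiple-≈ m k = [m+kn]%n≡m%n m k p

  *-multiple-≈ : ∀ k → k * p ≈ 0
  *-multiple-≈ k = +-*-multiple-≈ 0 k

  -- Add c * (p - 1), turning the common summand c into the multiple c * p.
  +-cancelʳ-≈ : ∀ {a b} c → a + c ≈ b + c → a ≈ b
  +-cancelʳ-≈ {a} {b} c a+c≈b+c = begin
    a                        ≈⟨ +-*-multiple-≈ a c ⟨
    a + c * p                ≡⟨ cong (a +_) c*p≡c+c*p′ ⟩
    a + (c + c * pred p)     ≡⟨ +-assoc a c _ ⟨
    a + c + c * pred p       ≈⟨ +-cong-≈ a+c≈b+c refl ⟩
    b + c + c * pred p       ≡⟨ +-assoc b c _ ⟩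
    b + (c + c * pred p)     ≡⟨ cong (b +_) c*p≡c+c*p′ ⟨
    b + c * p                ≈⟨ +-*-multiple-≈ b c ⟩
    b                        ∎
    where
    open ≈-Reasoning
    c*p≡c+c*p′ : c * p ≡ c + c * pred p
    c*p≡c+c*p′ = trans (cong (c *_) (sym (suc-pred p))) (*-suc c (pred p))

  ∃-inverse : Prime p → ∀ {d} → d ≢ 0 → d < p → ∃[ k ] k * d ≈ 1
  ∃-inverse p-prime {d} d≢0 d<p
    with coprime-Bézout (prime⇒coprime p-prime {{≢-nonZero d≢0}} d<p)
  ... | Bézout.-+ x y 1+xp≡yd = y , trans (cong (_% p) (sym 1+xp≡yd)) (+-*-multiple-≈ 1 x)
  -- Here y inverts -d, so (p - 1) y inverts d.
  ... | Bézout.+- x y 1+yd≡xp = pred p * y , +-cancelʳ-≈ (pred p) (begin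
    pred p * y * d + pred p      ≡⟨ distrib (pred p) y d ⟩
    pred p * (1 + y * d)         ≡⟨ cong (pred p *_) 1+yd≡xp ⟩
    pred p * (x * p)             ≡⟨ *-assoc (pred p) x p ⟨
    pred p * x * p               ≈⟨ *-multiple-≈ (pred p * x) ⟩
    0                            ≈⟨ *-multiple-≈ 1 ⟨
    1 * p                        ≡⟨ trans (*-identityˡ p) (sym (suc-pred p)) ⟩
    1 + pred p                   ∎)
    where
    open ≈-Reasoning
    distrib : ∀ q y d → q * y * d + q ≡ q * (1 + y * d)
    distrib = solve-∀

  toℕ-injective-≈ : ∀ {x y : Fin p} → toℕ x ≈ toℕ y → x ≡ y
  toℕ-injective-≈ {x} {y} x≈y = toℕ-injective (begin
    toℕ x        ≡⟨ m<n⇒m%n≡m (toℕ<n x) ⟨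
    toℕ x % p    ≡⟨ x≈y ⟩
    toℕ y % p    ≡⟨ m<n⇒m%n≡m (toℕ<n y) ⟩
    toℕ y        ∎)
    where open ≡-Reasoning

  toℕ-mod : ∀ m → toℕ (m mod p) ≈ m
  toℕ-mod m = trans (cong (_% p) (toℕ-fromℕ< (m%n<n m p))) (m%n%n≡m%n m p)

  infixl 6 _⊕_
  _⊕_ : Fin p → Fin p → Fin p
  x ⊕ y = (toℕ x + toℕ y) mod p

  toℕ-⊕ : ∀ x y → toℕ (x ⊕ y) ≈ toℕ x + toℕ y
  toℕ-⊕ x y = toℕ-mod (toℕ x + toℕ y)

  toℕ-⊖-+ : ∀ x y → toℕ (x ⊖ y) + toℕ y ≈ toℕ x
  toℕ-⊖-+ x y = begin
    toℕ (x ⊖ y) + toℕ y             ≈⟨ +-cong-≈ (toℕ-mod (toℕ x + (p ∸ toℕ y))) refl ⟩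
    toℕ x + (p ∸ toℕ y) + toℕ y     ≡⟨ +-assoc (toℕ x) _ _ ⟩
    toℕ x + (p ∸ toℕ y + toℕ y)     ≡⟨ cong (toℕ x +_) (m∸n+n≡m (<⇒≤ (toℕ<n y))) ⟩
    toℕ x + p                       ≈⟨ [m+n]%n≡m%n (toℕ x) p ⟩
    toℕ x                           ∎
    where open ≈-Reasoning

  ⊖-unique : ∀ {x y z} → toℕ z + toℕ y ≈ toℕ x → z ≡ x ⊖ y
  ⊖-unique {x} {y} z+y≈x =
    toℕ-injective-≈ (+-cancelʳ-≈ (toℕ y) (trans z+y≈x (sym (toℕ-⊖-+ x y))))

  ⊖-involutive : ∀ e x → e ⊖ (e ⊖ x) ≡ x
  ⊖-involutive e x = sym (⊖-unique (trans (cong (_% p) (+-comm (toℕ x) _)) (toℕ-⊖-+ e x)))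

  ⊖-reflect : ∀ e x y → (e ⊖ y) ⊖ (e ⊖ x) ≡ x ⊖ y
  ⊖-reflect e x y = sym (⊖-unique (+-cancelʳ-≈ (toℕ y) (begin
    toℕ (x ⊖ y) + toℕ (e ⊖ x) + toℕ y     ≡⟨ shuffle (toℕ (x ⊖ y)) _ _ ⟩
    toℕ (e ⊖ x) + (toℕ (x ⊖ y) + toℕ y)   ≈⟨ +-cong-≈ refl (toℕ-⊖-+ x y) ⟩
    toℕ (e ⊖ x) + toℕ x                   ≈⟨ toℕ-⊖-+ e x ⟩
    toℕ e                                 ≈⟨ toℕ-⊖-+ e y ⟨
    toℕ (e ⊖ y) + toℕ y                   ∎)))
    where
    open ≈-Reasoning
    shuffle : ∀ a b c → a + b + c ≡ b + (a + c)
    shuffle = solve-∀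

  ⊕-⊖-assoc : ∀ x y z → (x ⊕ y) ⊖ z ≡ x ⊕ (y ⊖ z)
  ⊕-⊖-assoc x y z = sym (⊖-unique (begin
    toℕ (x ⊕ (y ⊖ z)) + toℕ z        ≈⟨ +-cong-≈ (toℕ-⊕ x (y ⊖ z)) refl ⟩
    toℕ x + toℕ (y ⊖ z) + toℕ z      ≡⟨ +-assoc (toℕ x) _ _ ⟩
    toℕ x + (toℕ (y ⊖ z) + toℕ z)    ≈⟨ +-cong-≈ refl (toℕ-⊖-+ y z) ⟩
    toℕ x + toℕ y                    ≈⟨ toℕ-⊕ x y ⟨
    toℕ (x ⊕ y)                      ∎))
    where open ≈-Reasoning

  ⊕-⊖-cancel : ∀ x y → (x ⊕ y) ⊖ y ≡ x
  ⊕-⊖-cancel x y = sym (⊖-unique (sym (toℕ-⊕ x y)))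

  ⊖≢0 : ∀ {x y} → x ≢ y → toℕ (x ⊖ y) ≢ 0
  ⊖≢0 {x} {y} x≢y x⊖y≡0 = x≢y (toℕ-injective-≈ (begin
    toℕ x                  ≈⟨ toℕ-⊖-+ x y ⟨
    toℕ (x ⊖ y) + toℕ y    ≡⟨ cong (_+ toℕ y) x⊖y≡0 ⟩
    toℕ y                  ∎))
    where open ≈-Reasoning

  -- Translation by d ≢ 0 generates Fin p: j steps from a₀ reach x for j ≡ (x - a₀) d⁻¹.
  ⊕-closed⇒universal : Prime p → ∀ {ℓ} (P : Pred (Fin p) ℓ) {a₀ d : Fin p} → toℕ d ≢ 0 →
                       P a₀ → (∀ {a} → P a → P (a ⊕ d)) → ∀ x → P x
  ⊕-closed⇒universal p-prime P {a₀} {d} d≢0 Pa₀ closed x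
    with ∃-inverse p-prime d≢0 (toℕ<n d)
  ... | k , kd≈1 = subst P (toℕ-injective-≈ walk-reaches-x) (P-walk j)
    where
    walk : ℕ → Fin p
    walk zero    = a₀
    walk (suc i) = walk i ⊕ d

    P-walk : ∀ i → P (walk i)
    P-walk zero    = Pa₀
    P-walk (suc i) = closed (P-walk i)

    open ≈-Reasoning

    toℕ-walk : ∀ i → toℕ (walk i) ≈ toℕ a₀ + i * toℕ d
    toℕ-walk zero    = cong (_% p) (sym (+-identityʳ (toℕ a₀)))
    toℕ-walk (suc i) = begin
      toℕ (walk i ⊕ d)                   ≈⟨ toℕ-⊕ (walk i) d ⟩
      toℕ (walk i) + toℕ d               ≈⟨ +-cong-≈ (toℕ-walk i) refl ⟩
      toℕ a₀ + i * toℕ d + toℕ d         ≡⟨ step (toℕ a₀) i (toℕ d) ⟩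
      toℕ a₀ + suc i * toℕ d             ∎
      where
      step : ∀ a i d → a + i * d + d ≡ a + suc i * d
      step = solve-∀

    m = toℕ x + (p ∸ toℕ a₀)
    j = m * k

    walk-reaches-x : toℕ (walk j) ≈ toℕ x
    walk-reaches-x = begin
      toℕ (walk j)                       ≈⟨ toℕ-walk j ⟩
      toℕ a₀ + m * k * toℕ d             ≡⟨ cong (toℕ a₀ +_) (*-assoc m k (toℕ d)) ⟩
      toℕ a₀ + m * (k * toℕ d)           ≈⟨ +-cong-≈ {toℕ a₀} refl (*-cong-≈ {m} refl kd≈1) ⟩
      toℕ a₀ + m * 1                     ≡⟨ cong (toℕ a₀ +_) (*-identityʳ m) ⟩
      toℕ a₀ + (toℕ x + (p ∸ toℕ a₀))    ≡⟨ rearrange (toℕ a₀) (toℕ x) _ ⟩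
      toℕ x + (p ∸ toℕ a₀ + toℕ a₀)      ≡⟨ cong (toℕ x +_) (m∸n+n≡m (<⇒≤ (toℕ<n a₀))) ⟩
      toℕ x + p                          ≈⟨ [m+n]%n≡m%n (toℕ x) p ⟩
      toℕ x                              ∎
      where
      rearrange : ∀ a x r → a + (x + r) ≡ x + (r + a)
      rearrange = solve-∀

  -- Counting differences

  sum-reflect : ∀ e (f : Fin p → ℕ) → sum (f ∘ (e ⊖_)) ≡ sum f
  sum-reflect e f =
    sym (∑-permute f (permutation (e ⊖_) (e ⊖_) (⊖-involutive e) (⊖-involutive e)))

  -- x ↦ x ⊖ y is the composite of the reflections in y and in y ⊖ y.
  sum-translate : ∀ y (f : Fin p → ℕ) → sum (λ x → f (x ⊖ y)) ≡ sum f
  sum-translate y f = begin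
    sum (λ x → f (x ⊖ y))                 ≡⟨ sum-cong-≗ (λ x → cong f (⊖-reflect y x y)) ⟨
    sum (λ x → f ((y ⊖ y) ⊖ (y ⊖ x)))     ≡⟨ sum-reflect y (f ∘ ((y ⊖ y) ⊖_)) ⟩
    sum (λ x → f ((y ⊖ y) ⊖ x))           ≡⟨ sum-reflect (y ⊖ y) f ⟩
    sum f                                 ∎
    where open ≡-Reasoning

  diffWeight : (h a b : Fin p → ℕ) → ℕ
  diffWeight h a b = sum λ x → sum λ y → a x * b y * h (x ⊖ y)

  diffCount : (F A B : Fin p → Bool) → ℕ
  diffCount F A B = diffWeight (χ ∘ F) (χ ∘ A) (χ ∘ B)

  diffWeight-cong : ∀ h {a a′ b b′} → a ≗ a′ → b ≗ b′ → diffWeight h a b ≡ diffWeight h a′ b′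
  diffWeight-cong h a≗a′ b≗b′ =
    sum-cong-≗ λ x → sum-cong-≗ λ y → cong₂ (λ u v → u * v * h (x ⊖ y)) (a≗a′ x) (b≗b′ y)

  diffWeight-splitˡ : ∀ h {a} a₁ a₂ b → (∀ x → a x ≡ a₁ x + a₂ x) →
                      diffWeight h a b ≡ diffWeight h a₁ b + diffWeight h a₂ b
  diffWeight-splitˡ h {a} a₁ a₂ b a≡a₁+a₂ = trans
    (sum-cong-≗ λ x → sum-cong-≗ λ y → trans
      (cong (λ u → u * b y * h (x ⊖ y)) (a≡a₁+a₂ x))
      (distrib (a₁ x) (a₂ x) (b y) (h (x ⊖ y))))
    (∑∑-distrib-+ (λ x y → a₁ x * b y * h (x ⊖ y)) (λ x y → a₂ x * b y * h (x ⊖ y)))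
    where
    distrib : ∀ u v w z → (u + v) * w * z ≡ u * w * z + v * w * z
    distrib = solve-∀

  diffWeight-splitʳ : ∀ h a {b} b₁ b₂ → (∀ y → b y ≡ b₁ y + b₂ y) →
                      diffWeight h a b ≡ diffWeight h a b₁ + diffWeight h a b₂
  diffWeight-splitʳ h a {b} b₁ b₂ b≡b₁+b₂ = trans
    (sum-cong-≗ λ x → sum-cong-≗ λ y → trans
      (cong (λ u → a x * u * h (x ⊖ y)) (b≡b₁+b₂ y))
      (distrib (a x) (b₁ y) (b₂ y) (h (x ⊖ y))))
    (∑∑-distrib-+ (λ x y → a x * b₁ y * h (x ⊖ y)) (λ x y → a x * b₂ y * h (x ⊖ y)))
    where
    distrib : ∀ u v w z → u * (v + w) * z ≡ u * v * z + u * w * z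
    distrib = solve-∀

  -- The substitution (x, y) ↦ (e ⊖ y, e ⊖ x) preserves differences.
  diffWeight-reflect : ∀ e h a b → diffWeight h a b ≡ diffWeight h (b ∘ (e ⊖_)) (a ∘ (e ⊖_))
  diffWeight-reflect e h a b = begin
    sum (λ x → sum λ y → a x * b y * h (x ⊖ y))
      ≡⟨ ∑-comm (λ x y → a x * b y * h (x ⊖ y)) ⟩
    sum (λ y → sum λ x → a x * b y * h (x ⊖ y))
      ≡⟨ sum-cong-≗ (λ y → sum-reflect e (λ x → a x * b y * h (x ⊖ y))) ⟨
    sum (λ y → sum λ x → a (e ⊖ x) * b y * h ((e ⊖ x) ⊖ y))
      ≡⟨ sum-reflect e (λ y → sum λ x → a (e ⊖ x) * b y * h ((e ⊖ x) ⊖ y)) ⟨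
    sum (λ y → sum λ x → a (e ⊖ x) * b (e ⊖ y) * h ((e ⊖ x) ⊖ (e ⊖ y)))
      ≡⟨ sum-cong-≗ (λ y → sum-cong-≗ λ x →
           cong₂ _*_ (*-comm (a (e ⊖ x)) (b (e ⊖ y))) (cong h (⊖-reflect e y x))) ⟩
    sum (λ y → sum λ x → b (e ⊖ y) * a (e ⊖ x) * h (y ⊖ x))
      ∎
    where open ≡-Reasoning

  diffCount-+-complement : ∀ F A B → diffCount F A B + diffCount (not ∘ F) A B ≡ card A * card B
  diffCount-+-complement F A B = begin
    diffCount F A B + diffCount (not ∘ F) A B
      ≡⟨ ∑∑-distrib-+ (λ x y → w x y * χ (F (x ⊖ y))) (λ x y → w x y * χ (not (F (x ⊖ y)))) ⟨
    sum (λ x → sum λ y → w x y * χ (F (x ⊖ y)) + w x y * χ (not (F (x ⊖ y))))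
      ≡⟨ sum-cong-≗ (λ x → sum-cong-≗ λ y → trans
           (sym (*-distribˡ-+ (w x y) _ _)) (cong (w x y *_) (χ-+-not (F (x ⊖ y))))) ⟩
    sum (λ x → sum λ y → w x y * 1)
      ≡⟨ sum-cong-≗ (λ x → trans (sum-cong-≗ λ y → *-identityʳ (w x y)) (sym (*-distribˡ-sum (χ (A x)) (χ ∘ B)))) ⟩
    sum (λ x → χ (A x) * card B)
      ≡⟨ *-distribʳ-sum (card B) (χ ∘ A) ⟨
    card A * card B
      ∎
    where
    open ≡-Reasoning
    w : Fin p → Fin p → ℕ
    w x y = χ (A x) * χ (B y)

  card-+-card≤meet-+-p : ∀ A F y → card A + card F ≤ sum (λ x → χ (A x) * χ (F (x ⊖ y))) + p
  card-+-card≤meet-+-p A F y = begin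
    card A + card F                                  ≡⟨ cong (card A +_) (sum-translate y (χ ∘ F)) ⟨
    card A + sum (λ x → χ (F (x ⊖ y)))               ≡⟨ ∑-distrib-+ (χ ∘ A) (λ x → χ (F (x ⊖ y))) ⟨
    sum (λ x → χ (A x) + χ (F (x ⊖ y)))              ≤⟨ sum-mono-≤ (λ x → χ-+-≤ (A x) (F (x ⊖ y))) ⟩
    sum (λ x → χ (A x) * χ (F (x ⊖ y)) + 1)          ≡⟨ ∑-distrib-+ (λ x → χ (A x) * χ (F (x ⊖ y))) (λ _ → 1) ⟩
    sum (λ x → χ (A x) * χ (F (x ⊖ y))) + sum {p} (λ _ → 1)
                                                     ≡⟨ cong (sum (λ x → χ (A x) * χ (F (x ⊖ y))) +_) (sum-const-1 p) ⟩
    sum (λ x → χ (A x) * χ (F (x ⊖ y))) + p          ∎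
    where open ≤-Reasoning

  diffCount-lower-bound : ∀ F A B → card B * (card A + card F) ≤ diffCount F A B + card B * p
  diffCount-lower-bound F A B = begin
    card B * (card A + card F)                       ≡⟨ *-distribʳ-sum (card A + card F) (χ ∘ B) ⟩
    sum (λ y → χ (B y) * (card A + card F))          ≤⟨ sum-mono-≤ (λ y → *-monoʳ-≤ (χ (B y)) (card-+-card≤meet-+-p A F y)) ⟩
    sum (λ y → χ (B y) * (meet y + p))               ≡⟨ sum-cong-≗ (λ y → *-distribˡ-+ (χ (B y)) (meet y) p) ⟩
    sum (λ y → χ (B y) * meet y + χ (B y) * p)       ≡⟨ ∑-distrib-+ (λ y → χ (B y) * meet y) (λ y → χ (B y) * p) ⟩
    sum (λ y → χ (B y) * meet y) + sum (λ y → χ (B y) * p)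
                                                     ≡⟨ cong₂ _+_ meets≡diffCount (*-distribʳ-sum p (χ ∘ B)) ⟨
    diffCount F A B + card B * p                     ∎
    where
    open ≤-Reasoning
    meet : Fin p → ℕ
    meet y = sum (λ x → χ (A x) * χ (F (x ⊖ y)))
    reassoc : ∀ a b f → a * b * f ≡ b * (a * f)
    reassoc = solve-∀
    meets≡diffCount : diffCount F A B ≡ sum (λ y → χ (B y) * meet y)
    meets≡diffCount = trans (∑-comm (λ x y → χ (A x) * χ (B y) * χ (F (x ⊖ y))))
      (sum-cong-≗ λ y → trans
        (sum-cong-≗ λ x → reassoc (χ (A x)) (χ (B y)) (χ (F (x ⊖ y))))
        (sym (*-distribˡ-sum (χ (B y)) (λ x → χ (A x) * χ (F (x ⊖ y))))))

  -- If no a ∈ A had a ⊕ (b₁ ⊖ b₂) ∉ A, primality would make A all of Fin p.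
  ∃-separating-reflection : Prime p → ∀ A {b₁ b₂} → 1 ≤ card A → card A < p → b₁ ≢ b₂ →
                            ∃[ e ] A (e ⊖ b₁) ≡ true × A (e ⊖ b₂) ≡ false
  ∃-separating-reflection p-prime A {b₁} {b₂} 1≤∣A∣ ∣A∣<p b₁≢b₂
    with any? (λ a → (A a Bool.≟ true) ×-dec (A (a ⊕ (b₁ ⊖ b₂)) Bool.≟ false))
  ... | yes (a , Aa , ¬Aa⊕d) =
    a ⊕ b₁ , trans (cong A (⊕-⊖-cancel a b₁)) Aa , trans (cong A (⊕-⊖-assoc a b₁ b₂)) ¬Aa⊕d
  ... | no ∄exit = contradiction
    (card-universal A (⊕-closed⇒universal p-prime (λ x → A x ≡ true) (⊖≢0 b₁≢b₂)
                                           (proj₂ (card-∃ A 1≤∣A∣)) closed))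
    (<⇒≢ ∣A∣<p)
    where
    closed : ∀ {a} → A a ≡ true → A (a ⊕ (b₁ ⊖ b₂)) ≡ true
    closed {a} Aa with A (a ⊕ (b₁ ⊖ b₂)) in Aa⊕d
    ... | true  = refl
    ... | false = contradiction (a , Aa , Aa⊕d) ∄exit

  module DysonTransform (e : Fin p) (A B : Fin p → Bool) where

    A₁ A₂ B₁ B₂ : Fin p → Bool
    A₁ x = A x ∨ B (e ⊖ x)
    A₂ x = A x ∧ not (B (e ⊖ x))
    B₁ y = B y ∧ A (e ⊖ y)
    B₂ y = B y ∧ not (A (e ⊖ y))

    χB-split : ∀ y → χ (B y) ≡ χ (B₁ y) + χ (B₂ y)
    χB-split y = χ-split-∧ (B y) (A (e ⊖ y))

    χA-split : ∀ x → χ (A x) ≡ χ (A₂ x) + χ (B₁ (e ⊖ x))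
    χA-split x = begin
      χ (A x)                                  ≡⟨ χ-split-∧ (A x) (B (e ⊖ x)) ⟩
      χ (A x ∧ B (e ⊖ x)) + χ (A₂ x)           ≡⟨ +-comm _ (χ (A₂ x)) ⟩
      χ (A₂ x) + χ (A x ∧ B (e ⊖ x))           ≡⟨ cong (λ b → χ (A₂ x) + χ b) (∧-comm (A x) _) ⟩
      χ (A₂ x) + χ (B (e ⊖ x) ∧ A x)           ≡⟨ cong (λ z → χ (A₂ x) + χ (B (e ⊖ x) ∧ A z)) (⊖-involutive e x) ⟨
      χ (A₂ x) + χ (B₁ (e ⊖ x))                ∎
      where open ≡-Reasoning

    χA₁-split : ∀ x → χ (A₁ x) ≡ χ (A x) + χ (B₂ (e ⊖ x))
    χA₁-split x = trans (χ-split-∨ (A x) (B (e ⊖ x)))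
      (cong (λ z → χ (A x) + χ (B (e ⊖ x) ∧ not (A z))) (sym (⊖-involutive e x)))

    card-B : card B ≡ card B₁ + card B₂
    card-B = trans (sum-cong-≗ χB-split) (∑-distrib-+ (χ ∘ B₁) (χ ∘ B₂))

    card-A : card A ≡ card A₂ + card B₁
    card-A = trans (sum-cong-≗ χA-split) (trans (∑-distrib-+ (χ ∘ A₂) (χ ∘ B₁ ∘ (e ⊖_)))
                                                (cong (card A₂ +_) (sum-reflect e (χ ∘ B₁))))

    card-A₁ : card A₁ ≡ card A + card B₂
    card-A₁ = trans (sum-cong-≗ χA₁-split) (trans (∑-distrib-+ (χ ∘ A) (χ ∘ B₂ ∘ (e ⊖_)))
                                                  (cong (card A +_) (sum-reflect e (χ ∘ B₂))))

    -- The pairs (x, y) ∈ (e ⊖ B₁) × B₂ and (e ⊖ y, e ⊖ x) ∈ (e ⊖ B₂) × B₁ have the same difference.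
    diffCount-split : ∀ F → diffCount F A B ≡ diffCount F A₁ B₁ + diffCount F A₂ B₂
    diffCount-split F = begin
      W (χ ∘ A) (χ ∘ B)                        ≡⟨ diffWeight-splitʳ h (χ ∘ A) (χ ∘ B₁) (χ ∘ B₂) χB-split ⟩
      W (χ ∘ A) (χ ∘ B₁) + W (χ ∘ A) (χ ∘ B₂)  ≡⟨ cong (W (χ ∘ A) (χ ∘ B₁) +_) (diffWeight-splitˡ h (χ ∘ A₂) (χ ∘ B₁ ∘ (e ⊖_)) (χ ∘ B₂) χA-split) ⟩
      W (χ ∘ A) (χ ∘ B₁) + (W (χ ∘ A₂) (χ ∘ B₂) + W (χ ∘ B₁ ∘ (e ⊖_)) (χ ∘ B₂))
                                               ≡⟨ cong (λ z → W (χ ∘ A) (χ ∘ B₁) + (W (χ ∘ A₂) (χ ∘ B₂) + z)) crossed ⟨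
      W (χ ∘ A) (χ ∘ B₁) + (W (χ ∘ A₂) (χ ∘ B₂) + W (χ ∘ B₂ ∘ (e ⊖_)) (χ ∘ B₁))
                                               ≡⟨ swap-middle (W (χ ∘ A) (χ ∘ B₁)) _ _ ⟩
      W (χ ∘ A) (χ ∘ B₁) + W (χ ∘ B₂ ∘ (e ⊖_)) (χ ∘ B₁) + W (χ ∘ A₂) (χ ∘ B₂)
                                               ≡⟨ cong (_+ W (χ ∘ A₂) (χ ∘ B₂)) (diffWeight-splitˡ h (χ ∘ A) (χ ∘ B₂ ∘ (e ⊖_)) (χ ∘ B₁) χA₁-split) ⟨
      W (χ ∘ A₁) (χ ∘ B₁) + W (χ ∘ A₂) (χ ∘ B₂) ∎
      where
      open ≡-Reasoning
      h : Fin p → ℕ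
      h = χ ∘ F
      W : (Fin p → ℕ) → (Fin p → ℕ) → ℕ
      W = diffWeight h
      swap-middle : ∀ a b c → a + (b + c) ≡ a + c + b
      swap-middle = solve-∀
      crossed : W (χ ∘ B₂ ∘ (e ⊖_)) (χ ∘ B₁) ≡ W (χ ∘ B₁ ∘ (e ⊖_)) (χ ∘ B₂)
      crossed = trans (diffWeight-reflect e h (χ ∘ B₂ ∘ (e ⊖_)) (χ ∘ B₁))
                      (diffWeight-cong h {a = χ ∘ B₁ ∘ (e ⊖_)} {b = χ ∘ B₂ ∘ (e ⊖_) ∘ (e ⊖_)}
                                       (λ _ → refl) (λ y → cong (χ ∘ B₂) (⊖-involutive e y)))

  triples≡diffCount : ∀ D → triples D ≡ diffCount (lookup D) (lookup D) (lookup D)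
  triples≡diffCount D = trans (Σ[]≡sum (λ x → Σ[ (λ y → ind D x * ind D y * ind D (x ⊖ y)) ]))
    (sum-cong-≗ λ x → trans (Σ[]≡sum (λ y → ind D x * ind D y * ind D (x ⊖ y))) (sum-cong-≗ λ y →
      cong₂ _*_ (cong₂ _*_ (ind≡χ∘lookup D x) (ind≡χ∘lookup D y)) (ind≡χ∘lookup D (x ⊖ y))))

-- Pollard's inequality

bound-from-base : ∀ {t a b f r p} → b ≡ t → b * (a + f) ≤ r + b * p → t * (a + b + f) ≤ r + t * p + t * t
bound-from-base {t} {a} {f = f} {r} {p} refl b[a+f]≤r+bp = begin
  t * (a + t + f)       ≡⟨ expand t a f ⟩
  t * (a + f) + t * t   ≤⟨ +-monoˡ-≤ (t * t) b[a+f]≤r+bp ⟩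
  r + t * p + t * t     ∎
  where
  open ≤-Reasoning
  expand : ∀ t a f → t * (a + t + f) ≡ t * (a + f) + t * t
  expand = solve-∀

bound-from-part : ∀ {t a b f r a₁ b₁ r₁ p} → a₁ + b₁ ≡ a + b → r₁ ≤ r →
                  t * (a₁ + b₁ + f) ≤ r₁ + t * p + t * t → t * (a + b + f) ≤ r + t * p + t * t
bound-from-part {t} {a} {b} {f} {r} {a₁} {b₁} {r₁} {p} a₁+b₁≡a+b r₁≤r bound₁ = begin
  t * (a + b + f)       ≡⟨ cong (λ z → t * (z + f)) a₁+b₁≡a+b ⟨
  t * (a₁ + b₁ + f)     ≤⟨ bound₁ ⟩
  r₁ + t * p + t * t    ≤⟨ +-monoˡ-≤ (t * t) (+-monoˡ-≤ (t * p) r₁≤r) ⟩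
  r + t * p + t * t     ∎
  where open ≤-Reasoning

split-hypotheses : ∀ {t a b p} s u a₂ b₂ → t ≡ s + u → a ≡ a₂ + s → b ≡ s + b₂ →
                   t ≤ a → t ≤ b → a + b ≤ p + t → u ≤ a₂ × u ≤ b₂ × a₂ + b₂ ≤ p + u
split-hypotheses {p = p} s u a₂ b₂ refl refl refl t≤a t≤b a+b≤p+t =
  +-cancelˡ-≤ s u a₂ (subst (s + u ≤_) (+-comm a₂ s) t≤a) ,
  +-cancelˡ-≤ s u b₂ t≤b ,
  +-cancelʳ-≤ s (a₂ + b₂) (p + u) (begin
    a₂ + b₂ + s           ≤⟨ m≤m+n (a₂ + b₂ + s) s ⟩
    a₂ + b₂ + s + s       ≡⟨ regroup a₂ b₂ s ⟩
    a₂ + s + (s + b₂)     ≤⟨ a+b≤p+t ⟩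
    p + (s + u)           ≡⟨ shift p s u ⟩
    p + u + s             ∎)
  where
  open ≤-Reasoning
  regroup : ∀ a b s → a + b + s + s ≡ a + s + (s + b)
  regroup = solve-∀
  shift : ∀ p s u → p + (s + u) ≡ p + u + s
  shift = solve-∀

bound-from-split : ∀ {t a b f r a₁} s u a₂ b₂ r₁ r₂ p →
                   t ≡ s + u → a ≡ a₂ + s → b ≡ s + b₂ → a₁ ≡ a + b₂ → r ≡ r₁ + r₂ →
                   s * (a₁ + f) ≤ r₁ + s * p → u * (a₂ + b₂ + f) ≤ r₂ + u * p + u * u →
                   t * (a + b + f) ≤ r + t * p + t * t
bound-from-split {f = f} s u a₂ b₂ r₁ r₂ p refl refl refl refl refl bound₁ bound₂ = begin
  (s + u) * (a₂ + s + (s + b₂) + f)                ≡⟨ expand s u a₂ b₂ f ⟩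
  s * (a₂ + s + b₂ + f) + (u * (a₂ + b₂ + f) + c)  ≤⟨ +-mono-≤ bound₁ (+-monoˡ-≤ c bound₂) ⟩
  r₁ + s * p + (r₂ + u * p + u * u + c)            ≡⟨ collect s u r₁ r₂ p ⟩
  r₁ + r₂ + (s + u) * p + (s + u) * (s + u)        ∎
  where
  open ≤-Reasoning
  c : ℕ
  c = s * s + 2 * (u * s)
  expand : ∀ s u a b f → (s + u) * (a + s + (s + b) + f) ≡ s * (a + s + b + f) + (u * (a + b + f) + (s * s + 2 * (u * s)))
  expand = solve-∀
  collect : ∀ s u r₁ r₂ p → r₁ + s * p + (r₂ + u * p + u * u + (s * s + 2 * (u * s))) ≡ r₁ + r₂ + (s + u) * p + (s + u) * (s + u)
  collect = solve-∀

half-hypotheses : ∀ k {n p} → n ≡ 1 + k * 2 → 3 * n ≤ 2 * p + 1 → suc k ≤ n × n + n ≤ p + suc k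
half-hypotheses k {p = p} refl 3n≤2p+1 = s≤s (m≤m*n k 2) , (begin
  1 + k * 2 + (1 + k * 2)    ≡⟨ regroup k ⟩
  1 + 3 * k + suc k          ≤⟨ +-monoˡ-≤ (suc k) 1+3k≤p ⟩
  p + suc k                  ∎)
  where
  open ≤-Reasoning
  regroup : ∀ k → 1 + k * 2 + (1 + k * 2) ≡ 1 + 3 * k + suc k
  regroup = solve-∀
  expand : ∀ k → 3 * (1 + k * 2) ≡ 2 * (1 + 3 * k) + 1
  expand = solve-∀
  1+3k≤p : 1 + 3 * k ≤ p
  1+3k≤p = *-cancelˡ-≤ 2 (+-cancelʳ-≤ 1 _ _ (subst (_≤ 2 * p + 1) (expand k) 3n≤2p+1))

-- With n = 2k + 1 and t = k + 1, Pollard's bound says r ≥ k (k + 1), and 4 k (k + 1) = n² - 1.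
triples-arith : ∀ k {n f T r p} → n ≡ 1 + k * 2 → n + f ≡ p → T + r ≡ n * n →
                suc k * (n + n + f) ≤ r + suc k * p + suc k * suc k → 4 * T ≤ 3 * (n * n) + 1
triples-arith k {f = f} {T} {r} refl refl T+r≡n² pollard-bound =
  +-cancelʳ-≤ (4 * (k * suc k)) (4 * T) (3 * (n * n) + 1) (begin
    4 * T + 4 * (k * suc k)             ≤⟨ +-monoʳ-≤ (4 * T) (*-monoʳ-≤ 4 k[k+1]≤r) ⟩
    4 * T + 4 * r                       ≡⟨ *-distribˡ-+ 4 T r ⟨
    4 * (T + r)                         ≡⟨ cong (4 *_) T+r≡n² ⟩
    4 * (n * n)                         ≡⟨ square k ⟩
    3 * (n * n) + 1 + 4 * (k * suc k)   ∎)
  where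
  open ≤-Reasoning
  n w : ℕ
  n = 1 + k * 2
  w = suc k * (n + f) + suc k * suc k
  square : ∀ k → 4 * ((1 + k * 2) * (1 + k * 2)) ≡ 3 * ((1 + k * 2) * (1 + k * 2)) + 1 + 4 * (k * suc k)
  square = solve-∀
  split : ∀ k f → k * suc k + (suc k * (1 + k * 2 + f) + suc k * suc k) ≡ suc k * (1 + k * 2 + (1 + k * 2) + f)
  split = solve-∀
  k[k+1]≤r : k * suc k ≤ r
  k[k+1]≤r = +-cancelʳ-≤ w (k * suc k) r (begin
    k * suc k + w                       ≡⟨ split k f ⟩
    suc k * (n + n + f)                 ≤⟨ pollard-bound ⟩
    r + suc k * (n + f) + suc k * suc k ≡⟨ +-assoc r _ _ ⟩
    r + w                               ∎)

module _ {p : ℕ} .{{_ : NonZero p}} where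

  -- t (|A| + |B| + |F| − p − t) ≤ r_F(A, B), rearranged to avoid truncated subtraction.
  PollardBound : ℕ → (A B F : Fin p → Bool) → Set
  PollardBound t A B F = t ≤ card A → t ≤ card B → card A + card B ≤ p + t →
                         t * (card A + card B + card F) ≤ diffCount F A B + t * p + t * t

  module TransformBound {N} (IH : ∀ t A B F → card B ≤ N → PollardBound t A B F)
                        (t : ℕ) (A B F : Fin p → Bool) (e : Fin p) {b₁ b₂ : Fin p}
                        (Bb₁ : B b₁ ≡ true) (Ae⊖b₁ : A (e ⊖ b₁) ≡ true)
                        (Bb₂ : B b₂ ≡ true) (¬Ae⊖b₂ : A (e ⊖ b₂) ≡ false)
                        (∣B∣≤1+N : card B ≤ suc N) where

    open DysonTransform e A B

    1≤∣B₁∣ : 1 ≤ card B₁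
    1≤∣B₁∣ = subst (λ b → χ b ≤ card B₁) (cong₂ _∧_ Bb₁ Ae⊖b₁) (term≤sum (χ ∘ B₁) b₁)

    1≤∣B₂∣ : 1 ≤ card B₂
    1≤∣B₂∣ = subst (λ b → χ b ≤ card B₂) (cong₂ (λ b a → b ∧ not a) Bb₂ ¬Ae⊖b₂) (term≤sum (χ ∘ B₂) b₂)

    ∣B₁∣≤N : card B₁ ≤ N
    ∣B₁∣≤N = s≤s⁻¹ (≤-trans (subst (_≤ card B₁ + card B₂) (+-comm (card B₁) 1) (+-monoʳ-≤ (card B₁) 1≤∣B₂∣))
                            (subst (_≤ suc N) card-B ∣B∣≤1+N))

    ∣B₂∣≤N : card B₂ ≤ N
    ∣B₂∣≤N = s≤s⁻¹ (≤-trans (+-monoˡ-≤ (card B₂) 1≤∣B₁∣) (subst (_≤ suc N) card-B ∣B∣≤1+N))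

    ∣A₁∣+∣B₁∣≡∣A∣+∣B∣ : card A₁ + card B₁ ≡ card A + card B
    ∣A₁∣+∣B₁∣≡∣A∣+∣B∣ = begin
      card A₁ + card B₁               ≡⟨ cong (_+ card B₁) card-A₁ ⟩
      card A + card B₂ + card B₁      ≡⟨ +-assoc (card A) _ _ ⟩
      card A + (card B₂ + card B₁)    ≡⟨ cong (card A +_) (trans (+-comm (card B₂) _) (sym card-B)) ⟩
      card A + card B                 ∎
      where open ≡-Reasoning

    bound : PollardBound t A B F
    bound t≤∣A∣ t≤∣B∣ ∣A∣+∣B∣≤p+t with t ≤? card B₁
    ... | yes t≤∣B₁∣ = bound-from-part {t} {card A} {card B} {card F} {a₁ = card A₁} {card B₁} ∣A₁∣+∣B₁∣≡∣A∣+∣B∣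
      (subst (diffCount F A₁ B₁ ≤_) (sym (diffCount-split F)) (m≤m+n _ _))
      (IH t A₁ B₁ F ∣B₁∣≤N (≤-trans t≤∣A∣ (subst (card A ≤_) (sym card-A₁) (m≤m+n _ _))) t≤∣B₁∣
          (subst (_≤ p + t) (sym ∣A₁∣+∣B₁∣≡∣A∣+∣B∣) ∣A∣+∣B∣≤p+t))
    -- B₁ is too small for t: it gets the base bound with s = |B₁|, and (A₂, B₂) the remaining t - s.
    ... | no t≰∣B₁∣ = bound-from-split s u (card A₂) (card B₂) _ _ p
      t≡s+u card-A card-B card-A₁ (diffCount-split F)
      (diffCount-lower-bound F A₁ B₁)
      (IH u A₂ B₂ F ∣B₂∣≤N u≤∣A₂∣ u≤∣B₂∣ ∣A₂∣+∣B₂∣≤p+u)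
      where
      s u : ℕ
      s = card B₁
      u = t ∸ s
      t≡s+u : t ≡ s + u
      t≡s+u = sym (m+[n∸m]≡n (<⇒≤ (≰⇒> t≰∣B₁∣)))
      u-hypotheses : u ≤ card A₂ × u ≤ card B₂ × card A₂ + card B₂ ≤ p + u
      u-hypotheses = split-hypotheses s u (card A₂) (card B₂) t≡s+u card-A card-B t≤∣A∣ t≤∣B∣ ∣A∣+∣B∣≤p+t
      u≤∣A₂∣ : u ≤ card A₂
      u≤∣A₂∣ = proj₁ u-hypotheses
      u≤∣B₂∣ : u ≤ card B₂
      u≤∣B₂∣ = proj₁ (proj₂ u-hypotheses)
      ∣A₂∣+∣B₂∣≤p+u : card A₂ + card B₂ ≤ p + u
      ∣A₂∣+∣B₂∣≤p+u = proj₂ (proj₂ u-hypotheses)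

  pollard-fuel : Prime p → ∀ N t A B F → card B ≤ N → PollardBound t A B F
  pollard-fuel _ _ zero _ _ _ _ _ _ _ = z≤n
  pollard-fuel _ zero (suc _) _ _ _ ∣B∣≤0 _ t≤∣B∣ _ = contradiction (≤-trans t≤∣B∣ ∣B∣≤0) λ ()
  pollard-fuel p-prime (suc N) t@(suc _) A B F ∣B∣≤1+N t≤∣A∣ t≤∣B∣ ∣A∣+∣B∣≤p+t
    with card B ≤? t
  ... | yes ∣B∣≤t =
    bound-from-base {t} {card A} {card B} {card F} (≤-antisym ∣B∣≤t t≤∣B∣) (diffCount-lower-bound F A B)
  ... | no ∣B∣≰t with card-∃₂ B (≤-trans (s≤s (s≤s z≤n)) (≰⇒> ∣B∣≰t))
  ...   | b₁ , b₂ , b₁≢b₂ , Bb₁ , Bb₂ with ∃-separating-reflection p-prime A (≤-trans (s≤s z≤n) t≤∣A∣) ∣A∣<p b₁≢b₂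
    where
    ∣A∣<p : card A < p
    ∣A∣<p = +-cancelʳ-< (card B) (card A) p (≤-trans (s≤s ∣A∣+∣B∣≤p+t) (+-monoʳ-< p (≰⇒> ∣B∣≰t)))
  ...   | e , Ae⊖b₁ , ¬Ae⊖b₂ =
    TransformBound.bound (pollard-fuel p-prime N) t A B F e Bb₁ Ae⊖b₁ Bb₂ ¬Ae⊖b₂ ∣B∣≤1+N t≤∣A∣ t≤∣B∣ ∣A∣+∣B∣≤p+t

  pollard : Prime p → ∀ t A B F → PollardBound t A B F
  pollard p-prime t A B F = pollard-fuel p-prime (card B) t A B F ≤-refl

  odd-set-bound : Prime p → ∀ A k → card A ≡ 1 + k * 2 → 3 * card A ≤ 2 * p + 1 →
                  4 * diffCount A A A ≤ 3 * (card A * card A) + 1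
  odd-set-bound p-prime A k ∣A∣≡1+2k 3∣A∣≤2p+1 with half-hypotheses k ∣A∣≡1+2k 3∣A∣≤2p+1
  ... | t≤∣A∣ , ∣A∣+∣A∣≤p+t =
    triples-arith k {card A} {card (not ∘ A)} {diffCount A A A} {diffCount (not ∘ A) A A}
      ∣A∣≡1+2k (card-+-complement A) (diffCount-+-complement A A A)
      (pollard p-prime (suc k) A A (not ∘ A) t≤∣A∣ t≤∣A∣ ∣A∣+∣A∣≤p+t)

lemma3 : (p : ℕ) .{{_ : NonZero p}} → Prime p → (D : Subset p) →
         ∣ D ∣ % 2 ≡ 1 → 3 * ∣ D ∣ ≤ 2 * p + 1 →
         4 * triples D ≤ 3 * (∣ D ∣ * ∣ D ∣) + 1
lemma3 p p-prime D ∣D∣%2≡1 3∣D∣≤2p+1 =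
  subst₂ (λ T n → 4 * T ≤ 3 * (n * n) + 1) (sym (triples≡diffCount D)) (sym (∣∣≡card D))
    (odd-set-bound p-prime (lookup D) k ∣A∣≡1+2k (subst (λ n → 3 * n ≤ 2 * p + 1) (∣∣≡card D) 3∣D∣≤2p+1))
  where
  k : ℕ
  k = ∣ D ∣ / 2
  ∣A∣≡1+2k : card (lookup D) ≡ 1 + k * 2
  ∣A∣≡1+2k = trans (sym (∣∣≡card D)) (trans (m≡m%n+[m/n]*n ∣ D ∣ 2) (cong (_+ k * 2) ∣D∣%2≡1))
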